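{- Let $\mathcal T(\mathbf r,\mathbf c)$ and $\mathcal T(\mathbf r',\mathbf c')$ be two transportation polytopes of order $m\times n$ such that $\mathrm{VertAux}(\mathbf r,\mathbf c)=\mathrm{VertAux}(\mathbf r',\mathbf c')$. Let $T\in\mathrm{VertAux}(\mathbf r,\mathbf c)$, and let $M_T$ and $M_T'$ be the vertices of $\mathcal T(\mathbf r,\mathbf c)$ and $\mathcal T(\mathbf r',\mathbf c')$, respectively, whose auxiliary graph is $T$. Then $\mathrm{fcone}(\mathcal T(\mathbf r,\mathbf c),M_T)=\mathrm{fcone}(\mathcal T(\mathbf r',\mathbf c'),M_T')$.
   Context: For positive vectors $\mathbf r\in\mathbb R^m,\mathbf c\in\mathbb R^n$ with equal coordinate sums, the transportation polytope $\mathcal T(\mathbf r,\mathbf c)$ of order $m\times n$ is the set of nonnegative real $m\times n$ matrices with $i$th row sum $r_i$ and $j$th column sum $c_j$. $K_{m,n}$ is the complete bipartite graph with left vertices $u_1,\dots,u_m$, right vertices $w_1,\dots,w_n$ and edges $e_{i,j}=\{u_i,w_j\}$. The auxiliary graph $\operatorname{aux}(M)$ of a matrix $M$ is the spanning subgraph of $K_{m,n}$ with edge set $\{e_{i,j}: M(i,j)>0\}$; distinct vertices of $\mathcal T(\mathbf r,\mathbf c)$ have distinct auxiliary graphs. $\mathrm{VertAux}(\mathbf r,\mathbf c)$ is the set of auxiliary graphs of vertices of $\mathcal T(\mathbf r,\mathbf c)$. $\mathrm{fcone}(P,v)=\{u: v+\delta u\in P \text{ for all sufficiently small }\delta>0\}$.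 -}

module Defs where

open import Level using (0ℓ)
open import Data.Nat using (ℕ; zero; suc)
open import Data.Fin using (Fin; zero; suc)
open import Data.Product using (Σ; ∃; _×_; _,_)
open import Data.Sum using (_⊎_)
open import Relation.Binary.PropositionalEquality using (_≡_)
open import Relation.Nullary using (¬_)
open import Algebra.Structures using (IsCommutativeRing)
open import Relation.Binary.Structures using (IsStrictTotalOrder)
open import Function.Bundles using (_⇔_)

-- The real numbers, axiomatised as a Dedekind-complete ordered field
-- (every model is, classically, isomorphic to ℝ).  Equality is _≡_.

record RealNumbers : Set₁ where
  infixl 6 _+_
  infixl 7 _*_
  infix  4 _<_ _≤_
  field
    Carrier : Set
    _+_ _*_ : Carrier → Carrier → Carrier
    -_      : Carrier → Carrier
    0# 1#   : Carrier
    _<_     : Carrier → Carrier → Set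
    isCommutativeRing : IsCommutativeRing _≡_ _+_ _*_ -_ 0# 1#
    0≢1     : ¬ (0# ≡ 1#)
    inverse : ∀ x → ¬ (x ≡ 0#) → ∃ λ y → x * y ≡ 1#
    isStrictTotalOrder : IsStrictTotalOrder _≡_ _<_
    +-mono-< : ∀ {x y} z → x < y → x + z < y + z
    *-pos    : ∀ {x y} → 0# < x → 0# < y → 0# < x * y

  _≤_ : Carrier → Carrier → Set
  x ≤ y = x < y ⊎ x ≡ y

  field
    lub : (S : Carrier → Set) → (∃ λ x → S x) →
          (∃ λ b → ∀ x → S x → x ≤ b) →
          ∃ λ s → (∀ x → S x → x ≤ s) × (∀ b → (∀ x → S x → x ≤ b) → s ≤ b)

module Transport (ℝ : RealNumbers) where
  open RealNumbers ℝ

  sumFin : (n : ℕ) → (Fin n → Carrier) → Carrier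
  sumFin zero    f = 0#
  sumFin (suc n) f = f zero + sumFin n (λ i → f (suc i))

  Matrix : ℕ → ℕ → Set
  Matrix m n = Fin m → Fin n → Carrier

  Positive : {k : ℕ} → (Fin k → Carrier) → Set
  Positive v = ∀ i → 0# < v i

  Admissible : (m n : ℕ) → (Fin m → Carrier) → (Fin n → Carrier) → Set
  Admissible m n r c = Positive r × Positive c × sumFin m r ≡ sumFin n c

  InTP : {m n : ℕ} → (Fin m → Carrier) → (Fin n → Carrier) → Matrix m n → Set
  InTP {m} {n} r c M =
    (∀ i j → 0# ≤ M i j) ×
    (∀ i → sumFin n (λ j → M i j) ≡ r i) ×
    (∀ j → sumFin m (λ i → M i j) ≡ c j)

  IsVertex : {m n : ℕ} → (Fin m → Carrier) → (Fin n → Carrier) → Matrix m n → Set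
  IsVertex r c V =
    InTP r c V ×
    (∀ X Y t → InTP r c X → InTP r c Y → 0# < t → t < 1# →
       (∀ i j → V i j ≡ t * X i j + (1# + - t) * Y i j) →
       ∀ i j → X i j ≡ Y i j)

  -- spanning subgraphs of K_{m,n}, given by their edge sets:
  -- G i j holds iff the edge e_{i,j} = {u_i , w_j} is present
  Graph : ℕ → ℕ → Set₁
  Graph m n = Fin m → Fin n → Set

  SameGraph : {m n : ℕ} → Graph m n → Graph m n → Set
  SameGraph G H = ∀ i j → G i j ⇔ H i j

  aux : {m n : ℕ} → Matrix m n → Graph m n
  aux M i j = 0# < M i j

  InVertAux : {m n : ℕ} → (Fin m → Carrier) → (Fin n → Carrier) → Graph m n → Set
  InVertAux r c G = Σ (Matrix _ _) λ M → IsVertex r c M × SameGraph (aux M) G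

  SameVertAux : {m n : ℕ} → (r : Fin m → Carrier) (c : Fin n → Carrier)
                (r' : Fin m → Carrier) (c' : Fin n → Carrier) → Set₁
  SameVertAux r c r' c' = ∀ G → InVertAux r c G ⇔ InVertAux r' c' G

  InFcone : {m n : ℕ} → (Fin m → Carrier) → (Fin n → Carrier) →
            Matrix m n → Matrix m n → Set
  InFcone r c V U =
    ∃ λ ε → 0# < ε ×
      (∀ δ → 0# < δ → δ < ε → InTP r c (λ i j → V i j + δ * U i j))

-- The feasible cone of a polytope {x ≥ 0 : Ax = b} at a point V consists of
-- the directions U with AU = 0 and U ≥ 0 wherever V vanishes.  For a
-- transportation polytope this says: U has zero row and column sums and is
-- nonnegative off the support graph aux(V).  The cone therefore depends only
-- on aux(V), not on the margins (r, c), so two vertices with the same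
-- auxiliary graph have the same feasible cone.
module Submission where

open import Defs
open import Data.Nat using (ℕ; zero; suc)
open import Data.Fin using (Fin; zero; suc)
open import Data.Product using (∃; _×_; _,_)
open import Data.Sum using (inj₁; inj₂)
open import Data.Empty using (⊥-elim)
open import Relation.Nullary using (¬_)
open import Relation.Binary.PropositionalEquality
open import Relation.Binary.Definitions using (tri<; tri≈; tri>)
open import Relation.Binary.Structures using (IsStrictTotalOrder)
open import Algebra.Bundles using (CommutativeRing)
open import Function.Bundles using (_⇔_; mk⇔; Equivalence)
import Function.Properties.Equivalence as ⇔

module OrderedFieldProperties (ℝ : RealNumbers) where
  open RealNumbers ℝ

  commutativeRing : CommutativeRing _ _
  commutativeRing = record { isCommutativeRing = isCommutativeRing }

  open CommutativeRing commutativeRing public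
    using (_-_; commutativeSemiring; +-assoc; +-identityˡ; +-identityʳ; -‿inverseˡ; -‿inverseʳ;
           *-identityˡ; *-identityʳ; *-assoc; *-comm; zeroʳ)
  open CommutativeRing commutativeRing using (ring)
  open import Algebra.Properties.Ring ring public
    using (-‿distribˡ-*; -‿distribʳ-*; -‿involutive; x[y-z]≈xy-xz; +-identityʳ-unique)
  open IsStrictTotalOrder isStrictTotalOrder public
    using (compare; <-respˡ-≈; <-respʳ-≈) renaming (trans to <-trans)
  open IsStrictTotalOrder isStrictTotalOrder using (irrefl)
  open ≡-Reasoning

  <-irrefl : ∀ {x} → ¬ (x < x)
  <-irrefl = irrefl refl

  <⇒≱ : ∀ {x y} → x < y → ¬ (y ≤ x)
  <⇒≱ x<y (inj₁ y<x) = <-irrefl (<-trans x<y y<x)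
  <⇒≱ x<y (inj₂ refl) = <-irrefl x<y

  x<d+x : ∀ {d} x → 0# < d → x < d + x
  x<d+x x 0<d = <-respˡ-≈ (+-identityˡ x) (+-mono-< x 0<d)

  x<y⇒0<y-x : ∀ {x y} → x < y → 0# < y - x
  x<y⇒0<y-x {x} x<y = <-respˡ-≈ (-‿inverseʳ x) (+-mono-< (- x) x<y)

  0<y-x⇒x<y : ∀ {x y} → 0# < y - x → x < y
  0<y-x⇒x<y {x} {y} 0<y-x = <-respʳ-≈ y-x+x≡y (x<d+x x 0<y-x)
    where
    y-x+x≡y : y - x + x ≡ y
    y-x+x≡y = begin
      y + - x + x   ≡⟨ +-assoc y (- x) x ⟩
      y + (- x + x) ≡⟨ cong (y +_) (-‿inverseˡ x) ⟩
      y + 0#        ≡⟨ +-identityʳ y ⟩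
      y             ∎

  x<0⇒0<-x : ∀ {x} → x < 0# → 0# < - x
  x<0⇒0<-x {x} x<0 = <-respʳ-≈ (+-identityˡ (- x)) (x<y⇒0<y-x x<0)

  *-monoˡ-< : ∀ {x y} z → 0# < z → x < y → z * x < z * y
  *-monoˡ-< {x} {y} z 0<z x<y =
    0<y-x⇒x<y (<-respʳ-≈ (x[y-z]≈xy-xz z y x) (*-pos 0<z (x<y⇒0<y-x x<y)))

  0<+≥0 : ∀ {a b} → 0# < a → 0# ≤ b → 0# < a + b
  0<+≥0 {a} 0<a (inj₁ 0<b) = <-trans 0<b (x<d+x _ 0<a)
  0<+≥0 {a} 0<a (inj₂ refl) = <-respʳ-≈ (sym (+-identityʳ a)) 0<a

  0≤* : ∀ {a b} → 0# < a → 0# ≤ b → 0# ≤ a * b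
  0≤* 0<a (inj₁ 0<b) = inj₁ (*-pos 0<a 0<b)
  0≤* {a} 0<a (inj₂ refl) = inj₂ (sym (zeroʳ a))

  -- 1 < 0 would make 1 = (-1)(-1) positive.
  0<1 : 0# < 1#
  0<1 with compare 0# 1#
  ... | tri< 0<1 _ _ = 0<1
  ... | tri≈ _ 0≡1 _ = ⊥-elim (0≢1 0≡1)
  ... | tri> _ _ 1<0 = ⊥-elim (<-irrefl (<-trans 1<0 (<-respʳ-≈ -1*-1≡1 (*-pos 0<-1 0<-1))))
    where
    0<-1 : 0# < - 1#
    0<-1 = x<0⇒0<-x 1<0
    -1*-1≡1 : - 1# * - 1# ≡ 1#
    -1*-1≡1 = begin
      - 1# * - 1#   ≡⟨ sym (-‿distribʳ-* (- 1#) 1#) ⟩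
      - (- 1# * 1#) ≡⟨ cong -_ (*-identityʳ (- 1#)) ⟩
      - - 1#        ≡⟨ -‿involutive 1# ⟩
      1#            ∎

  inverse-pos : ∀ {a w} → 0# < a → a * w ≡ 1# → 0# < w
  inverse-pos {a} {w} 0<a aw≡1 with compare 0# w
  ... | tri< 0<w _ _ = 0<w
  ... | tri≈ _ refl _ = ⊥-elim (0≢1 (trans (sym (zeroʳ a)) aw≡1))
  ... | tri> _ _ w<0 = ⊥-elim (<-irrefl (<-trans 0<1 1<0))
    where
    1<0 : 1# < 0#
    1<0 = <-respˡ-≈ aw≡1 (<-respʳ-≈ (zeroʳ a) (*-monoˡ-< a 0<a w<0))

  pos⇒≢0 : ∀ {x} → 0# < x → ¬ (x ≡ 0#)
  pos⇒≢0 0<x refl = <-irrefl 0<x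

  *-cancelˡ-0 : ∀ {d x} → 0# < d → d * x ≡ 0# → x ≡ 0#
  *-cancelˡ-0 {d} {x} 0<d dx≡0 with inverse d (pos⇒≢0 0<d)
  ... | e , de≡1 = begin
    x           ≡⟨ sym (trans (cong (_* x) de≡1) (*-identityˡ x)) ⟩
    d * e * x   ≡⟨ cong (_* x) (*-comm d e) ⟩
    e * d * x   ≡⟨ *-assoc e d x ⟩
    e * (d * x) ≡⟨ cong (e *_) dx≡0 ⟩
    e * 0#      ≡⟨ zeroʳ e ⟩
    0#          ∎

  0<2 : 0# < 1# + 1#
  0<2 = <-trans 0<1 (x<d+x 1# 0<1)

  ∃-between-0-and : ∀ {ε} → 0# < ε → ∃ λ δ → 0# < δ × δ < ε
  ∃-between-0-and {ε} 0<ε with inverse (1# + 1#) (pos⇒≢0 0<2)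
  ... | h , 2h≡1 = δ , 0<δ , <-respʳ-≈ δ+δ≡ε (<-respˡ-≈ (+-identityˡ δ) (+-mono-< δ 0<δ))
    where
    open import Algebra.Solver.Ring.NaturalCoefficients.Default commutativeSemiring
    δ = ε * h
    0<δ : 0# < δ
    0<δ = *-pos 0<ε (inverse-pos 0<2 2h≡1)
    δ+δ≡ε : δ + δ ≡ ε
    δ+δ≡ε = begin
      ε * h + ε * h       ≡⟨ solve 2 (λ e k → e :* k :+ e :* k := e :* ((con 1 :+ con 1) :* k)) refl ε h ⟩
      ε * ((1# + 1#) * h) ≡⟨ cong (ε *_) 2h≡1 ⟩
      ε * 1#              ≡⟨ *-identityʳ ε ⟩
      ε                   ∎

module FeasibleCone (ℝ : RealNumbers) where
  open RealNumbers ℝ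
  open Transport ℝ
  open OrderedFieldProperties ℝ
  open ≡-Reasoning

  Eventually : (Carrier → Set) → Set
  Eventually P = ∃ λ ε → 0# < ε × (∀ δ → 0# < δ → δ < ε → P δ)

  eventually-always : ∀ {P} → (∀ δ → 0# < δ → P δ) → Eventually P
  eventually-always P⁺ = 1# , 0<1 , λ δ 0<δ _ → P⁺ δ 0<δ

  eventually-map : ∀ {P Q} → (∀ δ → P δ → Q δ) → Eventually P → Eventually Q
  eventually-map P⇒Q (ε , 0<ε , P<ε) = ε , 0<ε , λ δ 0<δ δ<ε → P⇒Q δ (P<ε δ 0<δ δ<ε)

  eventually-× : ∀ {P Q} → Eventually P → Eventually Q → Eventually (λ δ → P δ × Q δ)
  eventually-× (ε , 0<ε , P<ε) (ε' , 0<ε' , Q<ε') with compare ε ε'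
  ... | tri< ε<ε' _ _ = ε , 0<ε , λ δ 0<δ δ<ε → P<ε δ 0<δ δ<ε , Q<ε' δ 0<δ (<-trans δ<ε ε<ε')
  ... | tri≈ _ refl _ = ε , 0<ε , λ δ 0<δ δ<ε → P<ε δ 0<δ δ<ε , Q<ε' δ 0<δ δ<ε
  ... | tri> _ _ ε'<ε = ε' , 0<ε' , λ δ 0<δ δ<ε' → P<ε δ 0<δ (<-trans δ<ε' ε'<ε) , Q<ε' δ 0<δ δ<ε'

  eventually-∀ : ∀ {k} {P : Fin k → Carrier → Set} →
                 (∀ i → Eventually (P i)) → Eventually (λ δ → ∀ i → P i δ)
  eventually-∀ {zero} _ = eventually-always λ _ _ ()
  eventually-∀ {suc k} {P} P⁺ = eventually-map (λ _ → combine)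
    (eventually-× (P⁺ zero) (eventually-∀ (λ i → P⁺ (suc i))))
    where
    combine : ∀ {δ} → P zero δ × (∀ i → P (suc i) δ) → ∀ i → P i δ
    combine (P₀ , Pₛ) zero = P₀
    combine (P₀ , Pₛ) (suc i) = Pₛ i

  eventually⇒∃ : ∀ {P} → Eventually P → ∃ λ δ → 0# < δ × P δ
  eventually⇒∃ (ε , 0<ε , P<ε) with ∃-between-0-and 0<ε
  ... | δ , 0<δ , δ<ε = δ , 0<δ , P<ε δ 0<δ δ<ε

  -- v + δu stays positive while δ < v / (-u).
  eventually-0<+*-neg : ∀ {v u} → 0# < v → u < 0# → Eventually (λ δ → 0# < v + δ * u)
  eventually-0<+*-neg {v} {u} 0<v u<0 with inverse (- u) (pos⇒≢0 (x<0⇒0<-x u<0))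
  ... | w , -uw≡1 = v * w , *-pos 0<v (inverse-pos 0<-u -uw≡1) , λ δ _ δ<vw →
    <-respʳ-≈ (v+-[-uδ]≡v+δu δ) (x<y⇒0<y-x (<-respʳ-≈ -u[vw]≡v (*-monoˡ-< (- u) 0<-u δ<vw)))
    where
    open import Algebra.Solver.Ring.NaturalCoefficients.Default commutativeSemiring
    0<-u : 0# < - u
    0<-u = x<0⇒0<-x u<0
    -u[vw]≡v : - u * (v * w) ≡ v
    -u[vw]≡v = begin
      - u * (v * w) ≡⟨ solve 3 (λ a v w → a :* (v :* w) := v :* (a :* w)) refl (- u) v w ⟩
      v * (- u * w) ≡⟨ cong (v *_) -uw≡1 ⟩
      v * 1#        ≡⟨ *-identityʳ v ⟩
      v             ∎
    v+-[-uδ]≡v+δu : ∀ δ → v - - u * δ ≡ v + δ * u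
    v+-[-uδ]≡v+δu δ = cong (v +_) (begin
      - (- u * δ) ≡⟨ -‿distribˡ-* (- u) δ ⟩
      - - u * δ   ≡⟨ cong (_* δ) (-‿involutive u) ⟩
      u * δ       ≡⟨ *-comm u δ ⟩
      δ * u       ∎)

  eventually-0<+* : ∀ {v} u → 0# < v → Eventually (λ δ → 0# < v + δ * u)
  eventually-0<+* u 0<v with compare 0# u
  ... | tri< 0<u _ _ = eventually-always λ δ 0<δ → 0<+≥0 0<v (0≤* 0<δ (inj₁ 0<u))
  ... | tri≈ _ 0≡u _ = eventually-always λ δ 0<δ → 0<+≥0 0<v (0≤* 0<δ (inj₂ 0≡u))
  ... | tri> _ _ u<0 = eventually-0<+*-neg 0<v u<0

  eventually-0≤+* : ∀ {v u} → 0# ≤ v → (¬ (0# < v) → 0# ≤ u) → Eventually (λ δ → 0# ≤ v + δ * u)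
  eventually-0≤+* (inj₁ 0<v) _ = eventually-map (λ _ → inj₁) (eventually-0<+* _ 0<v)
  eventually-0≤+* {u = u} (inj₂ refl) 0≤u = eventually-always λ δ 0<δ →
    subst (0# ≤_) (sym (+-identityˡ (δ * u))) (0≤* 0<δ (0≤u <-irrefl))

  0≤+*⇒0≤ : ∀ {v u δ} → 0# < δ → 0# ≤ v → ¬ (0# < v) → 0# ≤ v + δ * u → 0# ≤ u
  0≤+*⇒0≤ _ (inj₁ 0<v) 0≮v _ = ⊥-elim (0≮v 0<v)
  0≤+*⇒0≤ {u = u} {δ} 0<δ (inj₂ refl) _ 0≤δu with compare 0# u
  ... | tri< 0<u _ _ = inj₁ 0<u
  ... | tri≈ _ 0≡u _ = inj₂ 0≡u
  ... | tri> _ _ u<0 = ⊥-elim (<⇒≱ δu<0 0≤δu)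
    where
    δu<0 : 0# + δ * u < 0#
    δu<0 = <-respˡ-≈ (sym (+-identityˡ _)) (<-respʳ-≈ (zeroʳ δ) (*-monoˡ-< δ 0<δ u<0))

  sumFin-+-* : ∀ n (a b : Fin n → Carrier) δ →
               sumFin n (λ j → a j + δ * b j) ≡ sumFin n a + δ * sumFin n b
  sumFin-+-* zero a b δ = sym (trans (cong (0# +_) (zeroʳ δ)) (+-identityˡ 0#))
  sumFin-+-* (suc n) a b δ = begin
    a₀ + δ * b₀ + sumFin n (λ j → a' j + δ * b' j) ≡⟨ cong (a₀ + δ * b₀ +_) (sumFin-+-* n a' b' δ) ⟩
    a₀ + δ * b₀ + (Σa' + δ * Σb')                  ≡⟨ solve 5 (λ a₀ b₀ A B d → a₀ :+ d :* b₀ :+ (A :+ d :* B)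
                                                                   := a₀ :+ A :+ d :* (b₀ :+ B))
                                                               refl a₀ b₀ Σa' Σb' δ ⟩
    a₀ + Σa' + δ * (b₀ + Σb')                      ∎
    where
    open import Algebra.Solver.Ring.NaturalCoefficients.Default commutativeSemiring
    a' b' : Fin n → Carrier
    a' j = a (suc j)
    b' j = b (suc j)
    a₀ b₀ Σa' Σb' : Carrier
    a₀ = a zero
    b₀ = b zero
    Σa' = sumFin n a'
    Σb' = sumFin n b'

  sumFin-direction≡0 : ∀ {n} (a b : Fin n → Carrier) {s δ} → 0# < δ → sumFin n a ≡ s →
                       sumFin n (λ j → a j + δ * b j) ≡ s → sumFin n b ≡ 0#
  sumFin-direction≡0 {n} a b {s} {δ} 0<δ Σa≡s Σ[a+δb]≡s =
    *-cancelˡ-0 0<δ (+-identityʳ-unique s (δ * sumFin n b) (begin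
      s + δ * sumFin n b              ≡⟨ cong (_+ δ * sumFin n b) (sym Σa≡s) ⟩
      sumFin n a + δ * sumFin n b     ≡⟨ sym (sumFin-+-* n a b δ) ⟩
      sumFin n (λ j → a j + δ * b j) ≡⟨ Σ[a+δb]≡s ⟩
      s                               ∎))

  sumFin-+-*-≡ : ∀ {n} (a b : Fin n → Carrier) {s} δ → sumFin n a ≡ s → sumFin n b ≡ 0# →
                 sumFin n (λ j → a j + δ * b j) ≡ s
  sumFin-+-*-≡ {n} a b {s} δ Σa≡s Σb≡0 = begin
    sumFin n (λ j → a j + δ * b j) ≡⟨ sumFin-+-* n a b δ ⟩
    sumFin n a + δ * sumFin n b     ≡⟨ cong₂ (λ x y → x + δ * y) Σa≡s Σb≡0 ⟩
    s + δ * 0#                      ≡⟨ cong (s +_) (zeroʳ δ) ⟩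
    s + 0#                          ≡⟨ +-identityʳ s ⟩
    s                               ∎

  module _ {m n : ℕ} where

    InSupportCone : Graph m n → Matrix m n → Set
    InSupportCone G U =
      (∀ i → sumFin n (λ j → U i j) ≡ 0#) ×
      (∀ j → sumFin m (λ i → U i j) ≡ 0#) ×
      (∀ i j → ¬ G i j → 0# ≤ U i j)

    supportCone-resp : ∀ {G H U} → SameGraph G H → InSupportCone G U → InSupportCone H U
    supportCone-resp G⇔H (rows , cols , U≥0) =
      rows , cols , λ i j ¬Hij → U≥0 i j (λ Gij → ¬Hij (Equivalence.to (G⇔H i j) Gij))

    fcone⇒supportCone : ∀ {r c V U} → InTP r c V → InFcone r c V U → InSupportCone (aux V) U
    fcone⇒supportCone {V = V} {U} (V≥0 , Vrows , Vcols) V+δU-feasible with eventually⇒∃ V+δU-feasible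
    ... | δ , 0<δ , (W≥0 , Wrows , Wcols) =
      (λ i → sumFin-direction≡0 (V i) (U i) 0<δ (Vrows i) (Wrows i)) ,
      (λ j → sumFin-direction≡0 (λ i → V i j) (λ i → U i j) 0<δ (Vcols j) (Wcols j)) ,
      (λ i j 0≮Vij → 0≤+*⇒0≤ 0<δ (V≥0 i j) 0≮Vij (W≥0 i j))

    supportCone⇒fcone : ∀ {r c V U} → InTP r c V → InSupportCone (aux V) U → InFcone r c V U
    supportCone⇒fcone {V = V} {U} (V≥0 , Vrows , Vcols) (Urows , Ucols , U≥0) =
      eventually-map
        (λ δ W≥0 → W≥0 ,
                   (λ i → sumFin-+-*-≡ (V i) (U i) δ (Vrows i) (Urows i)) ,
                   (λ j → sumFin-+-*-≡ (λ i → V i j) (λ i → U i j) δ (Vcols j) (Ucols j)))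
        (eventually-∀ λ i → eventually-∀ λ j → eventually-0≤+* (V≥0 i j) (U≥0 i j))

    fcone⇔supportCone : ∀ {r c V G U} → InTP r c V → SameGraph (aux V) G →
                        InFcone r c V U ⇔ InSupportCone G U
    fcone⇔supportCone V∈T V↦G = mk⇔
      (λ U∈fcone → supportCone-resp V↦G (fcone⇒supportCone V∈T U∈fcone))
      (λ U∈cone → supportCone⇒fcone V∈T (supportCone-resp (λ i j → ⇔.sym (V↦G i j)) U∈cone))

open RealNumbers using (Carrier)
open Transport

corollary4p12 : (ℝ : RealNumbers) (m n : ℕ)
    (r r' : Fin m → Carrier ℝ) (c c' : Fin n → Carrier ℝ) →
    Admissible ℝ m n r c → Admissible ℝ m n r' c' →
    SameVertAux ℝ r c r' c' →
    (T : Graph ℝ m n) → InVertAux ℝ r c T →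
    (MT MT' : Matrix ℝ m n) →
    IsVertex ℝ r c MT → SameGraph ℝ (aux ℝ MT) T →
    IsVertex ℝ r' c' MT' → SameGraph ℝ (aux ℝ MT') T →
    (U : Matrix ℝ m n) → InFcone ℝ r c MT U ⇔ InFcone ℝ r' c' MT' U
corollary4p12 ℝ m n r r' c c' _ _ _ T _ MT MT' (MT∈T , _) MT↦T (MT'∈T' , _) MT'↦T U =
  ⇔.trans (fcone⇔supportCone MT∈T MT↦T) (⇔.sym (fcone⇔supportCone MT'∈T' MT'↦T))
  where open FeasibleCone ℝ
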